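{- For every integer $n \geq 1$, let $B_n^{(3)}$ be the triangular book graph with vertex set $\{a, b, c_1, \dots, c_n\}$ and edge set $\{ab\} \cup \{ac_i, bc_i : 1 \leq i \leq n\}$ (order $n+2$, size $2n+1$). Then $$ms\left(B_n^{(3)}\right) = \begin{cases} 3, & \text{if } n = 1, \\ 4, & \text{if } n = 5, \\ \infty, & \text{if } n \equiv 0 \pmod 4, \\ \left\lceil \frac{n+1}{2} \right\rceil, & \text{otherwise.} \end{cases}$$
   Context: The triangular book graph $B_n^{(3)}$ consists of $n$ triangles sharing a common edge $ab$. Let $G$ be a graph of order $N$ with no component of order at most $2$. An edge $k$-labeling $f: E(G) \to \{1, 2, \dots, k\}$ is a modular irregular $k$-labeling of $G$ if the map $w_f: V(G) \to \mathbb{Z}_N$, $w_f(x) = \left(\sum_{xy \in E(G)} f(xy)\right) \bmod N$ (the modular weight of $x$), is a bijection onto $\mathbb{Z}_N$, the group of integers modulo $N$. The modular irregularity strength $ms(G)$ is the minimum $k$ for which $G$ admits a modular irregular $k$-labeling, and $ms(G) = \infty$ if $G$ admits no modular irregular labeling. -}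

module Defs where

open import Data.Nat using (ℕ; zero; suc; _+_; _*_; _≤_; _%_; NonZero)
open import Data.Fin using (Fin; toℕ; fromℕ<; _≟_) renaming (zero to fzero; suc to fsuc)
open import Data.Fin.Base using (splitAt)
open import Data.Sum using (_⊎_; inj₁; inj₂)
open import Data.Product using (_×_; _,_; proj₁; proj₂; Σ)
open import Data.Bool using (if_then_else_)
open import Relation.Nullary using (¬_; Dec; does)
open import Relation.Nullary.Decidable using (_⊎-dec_)
open import Function.Definitions using (Bijective)
open import Relation.Binary.PropositionalEquality using (_≡_)

record Graph : Set where
  field
    order : ℕ
    size  : ℕ
    ends  : Fin size → Fin order × Fin order

open Graph public

sumFin : (m : ℕ) → (Fin m → ℕ) → ℕ
sumFin zero    g = 0
sumFin (suc m) g = g fzero + sumFin m (λ i → g (fsuc i))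

incident? : (G : Graph) → (e : Fin (size G)) → (x : Fin (order G)) → Dec (x ≡ proj₁ (ends G e) ⊎ x ≡ proj₂ (ends G e))
incident? G e x = (x ≟ proj₁ (ends G e)) ⊎-dec (x ≟ proj₂ (ends G e))

IsLabeling : (G : Graph) → ℕ → (Fin (size G) → ℕ) → Set
IsLabeling G k f = ∀ e → 1 ≤ f e × f e ≤ k

weight : (G : Graph) → (Fin (size G) → ℕ) → Fin (order G) → ℕ
weight G f x = sumFin (size G) (λ e → if does (incident? G e x) then f e else 0)

modWeight : (G : Graph) → .{{_ : NonZero (order G)}} →
            (Fin (size G) → ℕ) → Fin (order G) → Fin (order G)
modWeight G f x = Data.Fin.fromℕ< (Data.Nat.DivMod.m%n<n (weight G f x) (order G))
  where import Data.Nat.DivMod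

IsModIrregular : (G : Graph) → .{{_ : NonZero (order G)}} → ℕ → (Fin (size G) → ℕ) → Set
IsModIrregular G k f = IsLabeling G k f × Bijective _≡_ _≡_ (modWeight G f)

Admits : (G : Graph) → .{{_ : NonZero (order G)}} → ℕ → Set
Admits G k = Σ (Fin (size G) → ℕ) (IsModIrregular G k)

data ℕ∞ : Set where
  fin : ℕ → ℕ∞
  ∞   : ℕ∞

HasMS : (G : Graph) → .{{_ : NonZero (order G)}} → ℕ∞ → Set
HasMS G (fin k) = Admits G k × (∀ j → Admits G j → k ≤ j)
HasMS G ∞       = ∀ k → ¬ Admits G k

-- Triangular book B_n^(3): vertices Fin (2 + n): 0 = a, 1 = b, 2 + i = c_i.
-- Edges Fin (1 + (n + n)): 0 = ab, 1 + i = a c_i, 1 + n + i = b c_i.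
bookEnds : (n : ℕ) → Fin (1 + (n + n)) → Fin (2 + n) × Fin (2 + n)
bookEnds n fzero = fzero , fsuc fzero
bookEnds n (fsuc e) = edge (splitAt n e)
  where
  c : Fin n → Fin (2 + n)
  c i = fsuc (fsuc i)
  edge : Fin n ⊎ Fin n → Fin (2 + n) × Fin (2 + n)
  edge (inj₁ i) = fzero , c i
  edge (inj₂ i) = fsuc fzero , c i

book : ℕ → Graph
book n = record { order = 2 + n ; size = 1 + (n + n) ; ends = bookEnds n }

{-# OPTIONS --safe #-}
-- Lower bound: the spine vertices c_i have weights in [2, 2k] that stay distinct modulo N = n + 2, so n < 2k.
-- For n ≡ 0 (mod 4) the order N is ≡ 2 (mod 4): the vertex weights add up to twice the label sum, whereas a
-- bijection onto ℤ_N makes them add up to 0 + 1 + ⋯ + (N − 1) ≡ N / 2 (mod N), an odd residue.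
-- Upper bound: label so that a, b, c_i get the modular weights 0, 1, i + 2. The labels of the edges a c_i may be
-- chosen in intervals whose sums sweep at least N consecutive values, so the weight of a can be made a multiple
-- of N; the label r of ab is then fixed so that b gets weight 1, the total weight being 2 r + Σ (i + 2).
-- The exceptions n = 1, k = 2 and n = 5, k = 3 fail by a pigeonhole argument and a residue count.
module Submission where

open import Defs
open import Data.Bool using (if_then_else_)
open import Data.Empty using (⊥)
open import Data.Fin using (Fin; toℕ; fromℕ<; _≟_; splitAt; _↑ˡ_; _↑ʳ_) renaming (zero to fzero; suc to fsuc)
open import Data.Fin.Patterns using (0F; 1F; 2F; 3F)
open import Data.Fin.Properties
  using (all?; toℕ-injective; toℕ-fromℕ<; toℕ<n; toℕ-↑ˡ; toℕ-↑ʳ; splitAt-↑ˡ; splitAt-↑ʳ; splitAt⁻¹-↑ˡ; splitAt⁻¹-↑ʳ; injective⇒≤)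
  renaming (suc-injective to fsuc-injective)
open import Data.List using (_∷_; [])
open import Data.Nat
  using (ℕ; zero; suc; _+_; _*_; _∸_; _≤_; _<_; z≤n; s≤s; _%_; _/_; NonZero; pred; ⌈_/2⌉; ⌊_/2⌋; _≤?_; _<?_)
open import Data.Nat.Divisibility using (_∣_; divides)
open import Data.Nat.DivMod
  using (_divMod_; result; m%n<n; m≡m%n+[m/n]*n; m/n*n≤m; [m+kn]%n≡m%n; m*n%n≡0; m<n⇒m%n≡m; %-distribˡ-+; m%n%n≡m%n
        ; m∣n⇒o%n%m≡o%m)
open import Data.Nat.Properties hiding (_≟_)
open import Data.Nat.Tactic.RingSolver using (solve-∀; solve)
open import Data.Product using (_×_; _,_; proj₁; proj₂; ∃)
open import Data.Sum using (_⊎_; inj₁; inj₂; [_,_]′)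
open import Function.Bundles using (mk⤖)
open import Function.Definitions using (Bijective)
open import Function.Properties.Bijection using (⤖⇒↔)
open import Relation.Binary.PropositionalEquality
open import Relation.Nullary using (¬_; Dec; does; yes; no; contradiction)
open import Relation.Nullary.Decidable using (_⊎-dec_; _→-dec_; from-yes)
open import Algebra.Properties.CommutativeSemigroup +-commutativeSemigroup using (interchange)
import Algebra.Properties.CommutativeMonoid.Sum as MonoidSum

sumFin-cong : ∀ m {g h : Fin m → ℕ} → (∀ i → g i ≡ h i) → sumFin m g ≡ sumFin m h
sumFin-cong zero    g≗h = refl
sumFin-cong (suc m) g≗h = cong₂ _+_ (g≗h fzero) (sumFin-cong m (λ i → g≗h (fsuc i)))

sumFin-+ : ∀ m (g h : Fin m → ℕ) → sumFin m (λ i → g i + h i) ≡ sumFin m g + sumFin m h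
sumFin-+ zero    g h = refl
sumFin-+ (suc m) g h =
  trans (cong (g fzero + h fzero +_) (sumFin-+ m (λ i → g (fsuc i)) (λ i → h (fsuc i))))
        (interchange (g fzero) (h fzero) _ _)

sumFin-const : ∀ m c → sumFin m (λ _ → c) ≡ m * c
sumFin-const zero    c = refl
sumFin-const (suc m) c = cong (c +_) (sumFin-const m c)

sumFin-zero : ∀ m → sumFin m (λ _ → 0) ≡ 0
sumFin-zero m = trans (sumFin-const m 0) (*-zeroʳ m)

sumFin-mono-≤ : ∀ m {g h : Fin m → ℕ} → (∀ i → g i ≤ h i) → sumFin m g ≤ sumFin m h
sumFin-mono-≤ zero    g≤h = z≤n
sumFin-mono-≤ (suc m) g≤h = +-mono-≤ (g≤h fzero) (sumFin-mono-≤ m (λ i → g≤h (fsuc i)))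

sumFin-++ : ∀ m n (g : Fin (m + n) → ℕ) →
            sumFin (m + n) g ≡ sumFin m (λ i → g (i ↑ˡ n)) + sumFin n (λ j → g (m ↑ʳ j))
sumFin-++ zero    n g = refl
sumFin-++ (suc m) n g = trans (cong (g fzero +_) (sumFin-++ m n (λ i → g (fsuc i))))
                              (sym (+-assoc (g fzero) _ _))

sumFin-indicator : ∀ m (j : Fin m) (g : Fin m → ℕ) → sumFin m (λ i → if does (j ≟ i) then g i else 0) ≡ g j
sumFin-indicator (suc m) fzero    g = trans (cong (g fzero +_) (sumFin-zero m)) (+-identityʳ (g fzero))
sumFin-indicator (suc m) (fsuc j) g = sumFin-indicator m j (λ i → g (fsuc i))

sumFin-shift : ∀ m c → sumFin m (λ i → c + toℕ i) ≡ m * c + sumFin m toℕ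
sumFin-shift m c = trans (sumFin-+ m (λ _ → c) toℕ) (cong (_+ sumFin m toℕ) (sumFin-const m c))

sumFin-toℕ : ∀ m → sumFin m toℕ * 2 + m ≡ m * m
sumFin-toℕ zero    = refl
sumFin-toℕ (suc m) = begin
  sumFin m (λ i → suc (toℕ i)) * 2 + suc m  ≡⟨ cong (λ s → s * 2 + suc m) (sumFin-shift m 1) ⟩
  (m * 1 + sumFin m toℕ) * 2 + suc m        ≡⟨ regroup m (sumFin m toℕ) ⟩
  m * 2 + (sumFin m toℕ * 2 + m) + 1        ≡⟨ cong (λ s → m * 2 + s + 1) (sumFin-toℕ m) ⟩
  m * 2 + m * m + 1                         ≡⟨ solve (m ∷ []) ⟩
  suc m * suc m                             ∎
  where open ≡-Reasoning
        regroup : ∀ m t → (m * 1 + t) * 2 + suc m ≡ m * 2 + (t * 2 + m) + 1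
        regroup = solve-∀

triangular : ∀ m s → s * 2 + m ≡ m * m → sumFin m toℕ ≡ s
triangular m s eq = *-cancelʳ-≡ _ s 2 (+-cancelʳ-≡ m _ _ (trans (sumFin-toℕ m) (sym eq)))

sumFin-% : ∀ m N .{{_ : NonZero N}} (g : Fin m → ℕ) → sumFin m (λ i → g i % N) % N ≡ sumFin m g % N
sumFin-% zero    N g = refl
sumFin-% (suc m) N g = begin
  (g fzero % N + S%) % N              ≡⟨ %-distribˡ-+ (g fzero % N) S% N ⟩
  (g fzero % N % N + S% % N) % N      ≡⟨ cong₂ (λ x y → (x + y) % N) (m%n%n≡m%n (g fzero) N)
                                                                       (sumFin-% m N (λ i → g (fsuc i))) ⟩
  (g fzero % N + S % N) % N           ≡⟨ %-distribˡ-+ (g fzero) S N ⟨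
  (g fzero + S) % N                   ∎
  where open ≡-Reasoning
        S% S : ℕ
        S% = sumFin m (λ i → g (fsuc i) % N)
        S  = sumFin m (λ i → g (fsuc i))

sumFin-bijection : ∀ N (σ : Fin N → Fin N) → Bijective _≡_ _≡_ σ → (g : Fin N → ℕ) →
                   sumFin N (λ x → g (σ x)) ≡ sumFin N g
sumFin-bijection N σ σ-bij g = begin
  sumFin N (λ x → g (σ x))  ≡⟨ sumFin≡sum N _ ⟨
  sum (λ x → g (σ x))       ≡⟨ sum-permute g (⤖⇒↔ (mk⤖ σ-bij)) ⟨
  sum g                     ≡⟨ sumFin≡sum N g ⟩
  sumFin N g                ∎
  where
  open ≡-Reasoning
  open MonoidSum +-0-commutativeMonoid using (sum; sum-permute)
  sumFin≡sum : ∀ m (h : Fin m → ℕ) → sum h ≡ sumFin m h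
  sumFin≡sum zero    h = refl
  sumFin≡sum (suc m) h = cong (h fzero +_) (sumFin≡sum m (λ i → h (fsuc i)))

modWeight-toℕ : ∀ G .{{_ : NonZero (order G)}} f x → toℕ (modWeight G f x) ≡ weight G f x % order G
modWeight-toℕ G f x = toℕ-fromℕ< (m%n<n (weight G f x) (order G))

weight-injective : ∀ {G} .{{_ : NonZero (order G)}} {k f} → IsModIrregular G k f →
                   ∀ {x y} → weight G f x ≡ weight G f y → x ≡ y
weight-injective {G} {f = f} (_ , injective , _) {x} {y} wx≡wy = injective (toℕ-injective (begin
  toℕ (modWeight G f x)  ≡⟨ modWeight-toℕ G f x ⟩
  weight G f x % order G ≡⟨ cong (_% order G) wx≡wy ⟩
  weight G f y % order G ≡⟨ modWeight-toℕ G f y ⟨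
  toℕ (modWeight G f y)  ∎))
  where open ≡-Reasoning

acLabel bcLabel : ∀ {n} → (Fin (size (book n)) → ℕ) → Fin n → ℕ
acLabel {n} f i = f (fsuc (i ↑ˡ n))
bcLabel {n} f i = f (fsuc (n ↑ʳ i))

weight-book : ∀ n f x → weight (book n) f x ≡
  (if does (incident? (book n) 0F x) then f 0F else 0)
  + (sumFin n (λ i → if does ((x ≟ 0F) ⊎-dec (x ≟ fsuc (fsuc i))) then acLabel f i else 0)
   + sumFin n (λ i → if does ((x ≟ 1F) ⊎-dec (x ≟ fsuc (fsuc i))) then bcLabel f i else 0))
weight-book n f x =
  cong ((if does (incident? (book n) 0F x) then f 0F else 0) +_)
       (trans (sumFin-++ n n _) (cong₂ _+_ (sumFin-cong n ac-incident) (sumFin-cong n bc-incident)))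
  where
  ac-incident : ∀ i → (if does (incident? (book n) (fsuc (i ↑ˡ n)) x) then acLabel f i else 0)
                    ≡ (if does ((x ≟ 0F) ⊎-dec (x ≟ fsuc (fsuc i))) then acLabel f i else 0)
  ac-incident i rewrite splitAt-↑ˡ n i n = refl
  bc-incident : ∀ i → (if does (incident? (book n) (fsuc (n ↑ʳ i)) x) then bcLabel f i else 0)
                    ≡ (if does ((x ≟ 1F) ⊎-dec (x ≟ fsuc (fsuc i))) then bcLabel f i else 0)
  bc-incident i rewrite splitAt-↑ʳ n n i = refl

weight-a : ∀ n f → weight (book n) f 0F ≡ f 0F + sumFin n (acLabel f)
weight-a n f = trans (weight-book n f 0F)
  (cong (f 0F +_) (trans (cong (sumFin n (acLabel f) +_) (sumFin-zero n)) (+-identityʳ _)))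

weight-b : ∀ n f → weight (book n) f 1F ≡ f 0F + sumFin n (bcLabel f)
weight-b n f = trans (weight-book n f 1F) (cong (λ s → f 0F + (s + sumFin n (bcLabel f))) (sumFin-zero n))

weight-c : ∀ n f j → weight (book n) f (fsuc (fsuc j)) ≡ acLabel f j + bcLabel f j
weight-c n f j = trans (weight-book n f (fsuc (fsuc j)))
  (cong₂ _+_ (sumFin-indicator n j (acLabel f)) (sumFin-indicator n j (bcLabel f)))

m∸2<n∸1 : ∀ {w s} → 2 ≤ w → w ≤ s → w ∸ 2 < s ∸ 1
m∸2<n∸1 (s≤s (s≤s z≤n)) (s≤s w≤s) = w≤s

admits-book⇒n+1≤k+k : ∀ {n k} → Admits (book n) k → n + 1 ≤ k + k
admits-book⇒n+1≤k+k {n} {k} (f , irr@(labels , _)) = begin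
  n + 1             ≤⟨ +-monoˡ-≤ 1 (injective⇒≤ code-injective) ⟩
  k + k ∸ 1 + 1     ≡⟨ m∸n+n≡m 1≤k+k ⟩
  k + k             ∎
  where
  open ≤-Reasoning
  w : Fin n → ℕ
  w j = acLabel f j + bcLabel f j
  2≤w : ∀ j → 2 ≤ w j
  2≤w j = +-mono-≤ (proj₁ (labels _)) (proj₁ (labels _))
  w≤k+k : ∀ j → w j ≤ k + k
  w≤k+k j = +-mono-≤ (proj₂ (labels _)) (proj₂ (labels _))
  1≤k+k : 1 ≤ k + k
  1≤k+k = ≤-trans (proj₁ (labels 0F)) (≤-trans (proj₂ (labels 0F)) (m≤m+n k k))
  code : Fin n → Fin (k + k ∸ 1)
  code j = fromℕ< (m∸2<n∸1 (2≤w j) (w≤k+k j))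
  code-injective : ∀ {i j} → code i ≡ code j → i ≡ j
  code-injective {i} {j} eq = fsuc-injective (fsuc-injective (weight-injective {book n} irr (begin-equality
    weight (book n) f (fsuc (fsuc i))  ≡⟨ weight-c n f i ⟩
    w i                                ≡⟨ ∸-cancelʳ-≡ (2≤w i) (2≤w j) w∸2≡ ⟩
    w j                                ≡⟨ weight-c n f j ⟨
    weight (book n) f (fsuc (fsuc j))  ∎)))
    where w∸2≡ : w i ∸ 2 ≡ w j ∸ 2
          w∸2≡ = trans (sym (toℕ-fromℕ< _)) (trans (cong toℕ eq) (toℕ-fromℕ< _))

⌈n+1/2⌉≤ms : ∀ {n k} → Admits (book n) k → ⌈ n + 1 /2⌉ ≤ k
⌈n+1/2⌉≤ms {n} {k} adm = subst (⌈ n + 1 /2⌉ ≤_) (sym (n≡⌈n+n/2⌉ k)) (⌈n/2⌉-mono (admits-book⇒n+1≤k+k adm))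

sumFin-weight-% : ∀ {G} .{{_ : NonZero (order G)}} {k f} → IsModIrregular G k f →
                  sumFin (order G) (weight G f) % order G ≡ sumFin (order G) toℕ % order G
sumFin-weight-% {G} {f = f} (_ , bijective) = begin
  sumFin N (weight G f) % N                       ≡⟨ sumFin-% N N (weight G f) ⟨
  sumFin N (λ x → weight G f x % N) % N           ≡⟨ cong (_% N) (sumFin-cong N (modWeight-toℕ G f)) ⟨
  sumFin N (λ x → toℕ (modWeight G f x)) % N      ≡⟨ cong (_% N) (sumFin-bijection N _ bijective toℕ) ⟩
  sumFin N toℕ % N                                ∎
  where open ≡-Reasoning
        N : ℕ
        N = order G

sumFin-weight-book : ∀ n f →
  sumFin (2 + n) (weight (book n) f) ≡ (f 0F + sumFin n (acLabel f) + sumFin n (bcLabel f)) * 2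
sumFin-weight-book n f = begin
  weight (book n) f 0F + (weight (book n) f 1F + C)
    ≡⟨ cong₂ (λ x y → x + (y + C)) (weight-a n f) (weight-b n f) ⟩
  r + P + (r + Q + C)
    ≡⟨ cong (λ s → r + P + (r + Q + s)) (trans (sumFin-cong n (weight-c n f)) (sumFin-+ n (acLabel f) (bcLabel f))) ⟩
  r + P + (r + Q + (P + Q))
    ≡⟨ double r P Q ⟩
  (r + P + Q) * 2 ∎
  where open ≡-Reasoning
        double : ∀ r P Q → r + P + (r + Q + (P + Q)) ≡ (r + P + Q) * 2
        double = solve-∀
        r P Q C : ℕ
        r = f 0F
        P = sumFin n (acLabel f)
        Q = sumFin n (bcLabel f)
        C = sumFin n (λ j → weight (book n) f (fsuc (fsuc j)))

¬admits-book-t*4 : ∀ t k → ¬ Admits (book (t * 4)) k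
¬admits-book-t*4 t k (f , irregular) = 0≢1+n (begin
  0                                         ≡⟨ m*n%n≡0 S 2 ⟨
  S * 2 % 2                                 ≡⟨ m∣n⇒o%n%m≡o%m 2 N (S * 2) 2∣N ⟨
  S * 2 % N % 2                             ≡⟨ cong (λ x → x % N % 2) (sumFin-weight-book (t * 4) f) ⟨
  sumFin N (weight (book (t * 4)) f) % N % 2  ≡⟨ cong (_% 2) (sumFin-weight-% {book (t * 4)} irregular) ⟩
  sumFin N toℕ % N % 2                      ≡⟨ m∣n⇒o%n%m≡o%m 2 N (sumFin N toℕ) 2∣N ⟩
  sumFin N toℕ % 2                          ≡⟨ cong (_% 2) (triangular N (1 + (t * 3 + t * t * 4) * 2) (closed-form t)) ⟩
  (1 + (t * 3 + t * t * 4) * 2) % 2         ≡⟨ [m+kn]%n≡m%n 1 (t * 3 + t * t * 4) 2 ⟩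
  1                                         ∎)
  where
  open ≡-Reasoning
  N S : ℕ
  N = 2 + t * 4
  S = f 0F + sumFin (t * 4) (acLabel f) + sumFin (t * 4) (bcLabel f)
  2∣N : 2 ∣ N
  2∣N = divides (1 + t * 2) (even t)
    where even : ∀ t → 2 + t * 4 ≡ (1 + t * 2) * 2
          even = solve-∀
  closed-form : ∀ t → (1 + (t * 3 + t * t * 4) * 2) * 2 + (2 + t * 4) ≡ (2 + t * 4) * (2 + t * 4)
  closed-form = solve-∀

¬admits-book-4∣n : ∀ n → n % 4 ≡ 0 → ∀ k → ¬ Admits (book n) k
¬admits-book-4∣n n n%4≡0 = subst (λ m → ∀ k → ¬ Admits (book m) k) (sym n≡[n/4]*4) (¬admits-book-t*4 (n / 4))
  where n≡[n/4]*4 : n ≡ n / 4 * 4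
        n≡[n/4]*4 = trans (m≡m%n+[m/n]*n n 4) (cong (_+ n / 4 * 4) n%4≡0)

module _ {n k} {f : Fin (size (book n)) → ℕ} (irregular : IsModIrregular (book n) k f) (tight : k + k ≤ suc n) where

  toℕ-modWeight-c : ∀ j → toℕ (modWeight (book n) f (fsuc (fsuc j))) ≡ acLabel f j + bcLabel f j
  toℕ-modWeight-c j = begin
    toℕ (modWeight (book n) f (fsuc (fsuc j)))  ≡⟨ modWeight-toℕ (book n) f (fsuc (fsuc j)) ⟩
    weight (book n) f (fsuc (fsuc j)) % (2 + n) ≡⟨ cong (_% (2 + n)) (weight-c n f j) ⟩
    (acLabel f j + bcLabel f j) % (2 + n)       ≡⟨ m<n⇒m%n≡m (s≤s (≤-trans w≤k+k tight)) ⟩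
    acLabel f j + bcLabel f j                   ∎
    where
    open ≡-Reasoning
    w≤k+k : acLabel f j + bcLabel f j ≤ k + k
    w≤k+k = +-mono-≤ (proj₂ (proj₁ irregular _)) (proj₂ (proj₁ irregular _))

  modWeight-a-b : (modWeight (book n) f 0F ≡ 0F × modWeight (book n) f 1F ≡ 1F)
                ⊎ (modWeight (book n) f 0F ≡ 1F × modWeight (book n) f 1F ≡ 0F)
  modWeight-a-b = pair (preimage 0F (s≤s z≤n)) (preimage 1F (s≤s (s≤s z≤n)))
    where
    mw : Fin (2 + n) → Fin (2 + n)
    mw = modWeight (book n) f
    not-c : ∀ {j y} → toℕ y < 2 → mw (fsuc (fsuc j)) ≢ y
    not-c {j} y<2 refl = <⇒≱ y<2
      (subst (2 ≤_) (sym (toℕ-modWeight-c j)) (+-mono-≤ (proj₁ (proj₁ irregular _)) (proj₁ (proj₁ irregular _))))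
    preimage : ∀ y → toℕ y < 2 → mw 0F ≡ y ⊎ mw 1F ≡ y
    preimage y y<2 with proj₂ (proj₂ irregular) y
    ... | 0F , mw≡y = inj₁ (mw≡y refl)
    ... | 1F , mw≡y = inj₂ (mw≡y refl)
    ... | fsuc (fsuc j) , mw≡y = contradiction (mw≡y refl) (not-c y<2)
    pair : mw 0F ≡ 0F ⊎ mw 1F ≡ 0F → mw 0F ≡ 1F ⊎ mw 1F ≡ 1F →
           (mw 0F ≡ 0F × mw 1F ≡ 1F) ⊎ (mw 0F ≡ 1F × mw 1F ≡ 0F)
    pair (inj₁ a↦0) (inj₂ b↦1) = inj₁ (a↦0 , b↦1)
    pair (inj₂ b↦0) (inj₁ a↦1) = inj₂ (a↦1 , b↦0)
    pair (inj₁ a↦0) (inj₁ a↦1) with () ← trans (sym a↦0) a↦1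
    pair (inj₂ b↦0) (inj₂ b↦1) with () ← trans (sym b↦0) b↦1

1+[p+q∸suc[k]]≤p : ∀ {p q k} → 1 ≤ p → q ≤ k → 1 + (p + q ∸ suc k) ≤ p
1+[p+q∸suc[k]]≤p {suc p} {q} {k} _ q≤k =
  s≤s (≤-trans (∸-monoˡ-≤ k (+-monoʳ-≤ p q≤k)) (≤-reflexive (m+n∸n≡m p k)))

s%7<2⇒14≤s : ∀ s → s < 16 → 9 ≤ s → s % 7 < 2 → 14 ≤ s
s%7<2⇒14≤s s s<16 = subst Window (toℕ-fromℕ< s<16)
  (from-yes (all? {P = λ (i : Fin 16) → Window (toℕ i)} (λ i → Window? (toℕ i))) (fromℕ< s<16))
  where
  Window : ℕ → Set
  Window s = 9 ≤ s → s % 7 < 2 → 14 ≤ s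
  Window? : ∀ s → Dec (Window s)
  Window? s = 9 ≤? s →-dec (s % 7 <? 2 →-dec 14 ≤? s)

¬small-residues : ∀ {r P Q} → 1 ≤ r → r ≤ 3 → 8 ≤ P → 8 ≤ Q → P + Q ≡ 20 →
                  (r + P) % 7 < 2 → (r + Q) % 7 < 2 → ⊥
¬small-residues {r} {P} {Q} 1≤r r≤3 8≤P 8≤Q P+Q≡20 r+P%7<2 r+Q%7<2 = <⇒≱ (n≤1+n 27) (begin
  28                 ≤⟨ +-mono-≤ (14≤r+ 8≤P 8≤Q P+Q≡20 r+P%7<2)
                                 (14≤r+ 8≤Q 8≤P (trans (+-comm Q P) P+Q≡20) r+Q%7<2) ⟩
  r + P + (r + Q)    ≡⟨ regroup r P Q ⟩
  r + r + (P + Q)    ≡⟨ cong (r + r +_) P+Q≡20 ⟩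
  r + r + 20         ≤⟨ +-monoˡ-≤ 20 (+-mono-≤ r≤3 r≤3) ⟩
  26                 ∎)
  where
  open ≤-Reasoning
  regroup : ∀ r P Q → r + P + (r + Q) ≡ r + r + (P + Q)
  regroup = solve-∀
  14≤r+ : ∀ {X Y} → 8 ≤ X → 8 ≤ Y → X + Y ≡ 20 → (r + X) % 7 < 2 → 14 ≤ r + X
  14≤r+ {X} {Y} 8≤X 8≤Y X+Y≡20 = s%7<2⇒14≤s (r + X) (s≤s (+-mono-≤ r≤3 X≤12)) (+-mono-≤ 1≤r 8≤X)
    where X≤12 : X ≤ 12
          X≤12 = +-cancelʳ-≤ 8 X 12 (≤-trans (+-monoʳ-≤ X 8≤Y) (≤-reflexive X+Y≡20))

-- The five spine vertices take exactly the weights 2, …, 6, hence a and b take 0 and 1. Summing a function g of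
-- the modular weights over all vertices therefore gives g 0 + ⋯ + g 6; for g v = v this yields Σ ac + Σ bc = 20,
-- and for g v = 1 + (v ∸ 4), a lower bound for each label at a spine vertex of weight v, it yields Σ ac, Σ bc ≥ 8.
¬admits-book-5-3 : ¬ Admits (book 5) 3
¬admits-book-5-3 (f , irregular@(labels , bijective)) =
  ¬small-residues (proj₁ (labels 0F)) (proj₂ (labels 0F)) 8≤P 8≤Q P+Q≡20 (residue-a A<2) (residue-b B<2)
  where
  open ≡-Reasoning
  mw : Fin 7 → Fin 7
  mw = modWeight (book 5) f
  A B P Q : ℕ
  A = toℕ (mw 0F)
  B = toℕ (mw 1F)
  P = sumFin 5 (acLabel f)
  Q = sumFin 5 (bcLabel f)
  w : Fin 5 → ℕ
  w j = acLabel f j + bcLabel f j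

  a-b-small : ∀ {x y : Fin 7} → (x ≡ 0F × y ≡ 1F) ⊎ (x ≡ 1F × y ≡ 0F) →
              (toℕ x < 2 × toℕ y < 2) × toℕ x + toℕ y ≡ 1
  a-b-small (inj₁ (refl , refl)) = (s≤s z≤n , s≤s (s≤s z≤n)) , refl
  a-b-small (inj₂ (refl , refl)) = (s≤s (s≤s z≤n) , s≤s z≤n) , refl

  A-B-small : (A < 2 × B < 2) × A + B ≡ 1
  A-B-small = a-b-small (modWeight-a-b irregular ≤-refl)
  A<2 : A < 2
  A<2 = proj₁ (proj₁ A-B-small)
  B<2 : B < 2
  B<2 = proj₂ (proj₁ A-B-small)

  sumFin-weights : ∀ g → g A + g B + sumFin 5 (λ j → g (w j)) ≡ sumFin 7 (λ x → g (toℕ x))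
  sumFin-weights g = begin
    g A + g B + sumFin 5 (λ j → g (w j))
      ≡⟨ cong (g A + g B +_) (sumFin-cong 5 (λ j → cong g (sym (toℕ-modWeight-c irregular ≤-refl j)))) ⟩
    g A + g B + sumFin 5 (λ j → g (toℕ (mw (fsuc (fsuc j)))))
      ≡⟨ +-assoc (g A) _ _ ⟩
    sumFin 7 (λ x → g (toℕ (mw x)))
      ≡⟨ sumFin-bijection 7 mw bijective (λ x → g (toℕ x)) ⟩
    sumFin 7 (λ x → g (toℕ x)) ∎

  least : ℕ → ℕ
  least v = 1 + (v ∸ 4)

  least-small : ∀ {v} → v < 2 → least v ≡ 1
  least-small (s≤s z≤n)       = refl
  least-small (s≤s (s≤s z≤n)) = refl

  Σw≡20 : sumFin 5 w ≡ 20
  Σw≡20 = +-cancelˡ-≡ 1 _ _ (trans (cong (_+ sumFin 5 w) (sym (proj₂ A-B-small))) (sumFin-weights (λ v → v)))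

  Σleast≡8 : sumFin 5 (λ j → least (w j)) ≡ 8
  Σleast≡8 = +-cancelˡ-≡ 2 _ _
    (trans (cong₂ (λ x y → x + y + sumFin 5 (λ j → least (w j))) (sym (least-small A<2)) (sym (least-small B<2)))
           (sumFin-weights least))

  8≤P : 8 ≤ P
  8≤P = subst (_≤ P) Σleast≡8
    (sumFin-mono-≤ 5 (λ j → 1+[p+q∸suc[k]]≤p (proj₁ (labels (fsuc (j ↑ˡ 5)))) (proj₂ (labels (fsuc (5 ↑ʳ j))))))
  8≤Q : 8 ≤ Q
  8≤Q = subst (_≤ Q) Σleast≡8 (sumFin-mono-≤ 5 (λ j →
    subst (λ v → least v ≤ bcLabel f j) (+-comm (bcLabel f j) (acLabel f j))
          (1+[p+q∸suc[k]]≤p (proj₁ (labels (fsuc (5 ↑ʳ j)))) (proj₂ (labels (fsuc (j ↑ˡ 5)))))))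
  P+Q≡20 : P + Q ≡ 20
  P+Q≡20 = trans (sym (sumFin-+ 5 (acLabel f) (bcLabel f))) Σw≡20

  residue-a : A < 2 → (f 0F + P) % 7 < 2
  residue-a = subst (_< 2) (trans (modWeight-toℕ (book 5) f 0F) (cong (_% 7) (weight-a 5 f)))
  residue-b : B < 2 → (f 0F + Q) % 7 < 2
  residue-b = subst (_< 2) (trans (modWeight-toℕ (book 5) f 1F) (cong (_% 7) (weight-b 5 f)))

one-or-two : ∀ {x} → 1 ≤ x → x ≤ 2 → x ≡ 1 ⊎ x ≡ 2
one-or-two {1} _ _ = inj₁ refl
one-or-two {2} _ _ = inj₂ refl
one-or-two {suc (suc (suc _))} _ (s≤s (s≤s ()))

two-equal : ∀ {x y z : ℕ} → x ≡ 1 ⊎ x ≡ 2 → y ≡ 1 ⊎ y ≡ 2 → z ≡ 1 ⊎ z ≡ 2 → x ≡ y ⊎ x ≡ z ⊎ y ≡ z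
two-equal (inj₁ refl) (inj₁ refl) _           = inj₁ refl
two-equal (inj₂ refl) (inj₂ refl) _           = inj₁ refl
two-equal (inj₁ refl) (inj₂ refl) (inj₁ refl) = inj₂ (inj₁ refl)
two-equal (inj₁ refl) (inj₂ refl) (inj₂ refl) = inj₂ (inj₂ refl)
two-equal (inj₂ refl) (inj₁ refl) (inj₁ refl) = inj₂ (inj₂ refl)
two-equal (inj₂ refl) (inj₁ refl) (inj₂ refl) = inj₂ (inj₁ refl)

-- Two of the three labels coincide, and then two of the three vertex weights coincide.
¬admits-book-1 : ∀ k → k ≤ 2 → ¬ Admits (book 1) k
¬admits-book-1 k k≤2 (f , irregular@(labels , _))
  with two-equal (label∈1,2 0F) (label∈1,2 (fsuc 0F)) (label∈1,2 (fsuc 1F))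
  where label∈1,2 : ∀ e → f e ≡ 1 ⊎ f e ≡ 2
        label∈1,2 e = one-or-two (proj₁ (labels e)) (≤-trans (proj₂ (labels e)) k≤2)
... | inj₁ r≡p with () ← weight-injective {book 1} irregular {1F} {fsuc 1F}
      (trans (weight-b 1 f) (trans (cong₂ _+_ r≡p (+-identityʳ _)) (sym (weight-c 1 f 0F))))
... | inj₂ (inj₁ r≡q) with () ← weight-injective {book 1} irregular {0F} {fsuc 1F}
      (trans (weight-a 1 f) (trans (cong₂ _+_ r≡q (+-identityʳ _))
                            (trans (+-comm (f (fsuc 1F)) (f (fsuc 0F))) (sym (weight-c 1 f 0F)))))
... | inj₂ (inj₂ p≡q) with () ← weight-injective {book 1} irregular {0F} {1F}
      (trans (weight-a 1 f) (trans (cong (λ x → f 0F + (x + 0)) p≡q) (sym (weight-b 1 f))))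

bijective-≗id : ∀ {N} {σ : Fin N → Fin N} → (∀ x → σ x ≡ x) → Bijective _≡_ _≡_ σ
bijective-≗id σ≗id = (λ {x} {y} σx≡σy → trans (sym (σ≗id x)) (trans σx≡σy (σ≗id y)))
                   , (λ y → y , λ {z} z≡y → trans (σ≗id z) z≡y)

bookLabeling : ∀ {n} → ℕ → (Fin n → ℕ) → (Fin n → ℕ) → Fin (size (book n)) → ℕ
bookLabeling     r p q fzero    = r
bookLabeling {n} r p q (fsuc e) = [ p , q ]′ (splitAt n e)

acLabel-bookLabeling : ∀ {n} r p q i → acLabel (bookLabeling {n} r p q) i ≡ p i
acLabel-bookLabeling {n} r p q i = cong [ p , q ]′ (splitAt-↑ˡ n i n)

bcLabel-bookLabeling : ∀ {n} r p q i → bcLabel (bookLabeling {n} r p q) i ≡ q i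
bcLabel-bookLabeling {n} r p q i = cong [ p , q ]′ (splitAt-↑ʳ n n i)

book-admits : ∀ {n k} r (p q : Fin n → ℕ) → 1 ≤ r × r ≤ k → (∀ i → (1 ≤ p i × p i ≤ k) × (1 ≤ q i × q i ≤ k)) →
              (r + sumFin n p) % (2 + n) ≡ 0 → (r + sumFin n q) % (2 + n) ≡ 1 →
              (∀ i → (p i + q i) % (2 + n) ≡ 2 + toℕ i) → Admits (book n) k
book-admits {n} {k} r p q r∈ pq∈ a↦0 b↦1 c↦i+2 = f , labels , bijective-≗id modWeight≗id
  where
  f : Fin (size (book n)) → ℕ
  f = bookLabeling r p q
  labels : IsLabeling (book n) k f
  labels fzero = r∈
  labels (fsuc e) with splitAt n e
  ... | inj₁ i = proj₁ (pq∈ i)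
  ... | inj₂ i = proj₂ (pq∈ i)
  modWeight≗id : ∀ x → modWeight (book n) f x ≡ x
  modWeight≗id x = toℕ-injective (trans (modWeight-toℕ (book n) f x) (weight≡ x))
    where
    weight≡ : ∀ x → weight (book n) f x % (2 + n) ≡ toℕ x
    weight≡ 0F = trans (cong (_% (2 + n)) (trans (weight-a n f) (cong (r +_) (sumFin-cong n (acLabel-bookLabeling r p q)))))
                       a↦0
    weight≡ 1F = trans (cong (_% (2 + n)) (trans (weight-b n f) (cong (r +_) (sumFin-cong n (bcLabel-bookLabeling r p q)))))
                       b↦1
    weight≡ (fsuc (fsuc i)) = trans (cong (_% (2 + n)) (trans (weight-c n f i)
                                      (cong₂ _+_ (acLabel-bookLabeling r p q i) (bcLabel-bookLabeling r p q i))))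
                                    (c↦i+2 i)

Between : ∀ m → (Fin m → ℕ) → (Fin m → ℕ) → ℕ → Set
Between m lo hi D = ∃ λ (p : Fin m → ℕ) → (∀ i → lo i ≤ p i × p i ≤ hi i) × sumFin m p ≡ D

sumFin-between : ∀ m (lo hi : Fin m → ℕ) {D} → (∀ i → lo i ≤ hi i) → sumFin m lo ≤ D → D ≤ sumFin m hi →
                 Between m lo hi D
sumFin-between zero    lo hi lo≤hi _ D≤0 = (λ ()) , (λ ()) , sym (n≤0⇒n≡0 D≤0)
sumFin-between (suc m) lo hi {D} lo≤hi Σlo≤D D≤Σhi = choose (hi 0F ≤? D ∸ L)
  where
  lo′ hi′ : Fin m → ℕ
  lo′ i = lo (fsuc i)
  hi′ i = hi (fsuc i)
  L : ℕ
  L = sumFin m lo′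
  recurse : ∀ {D′} → L ≤ D′ → D′ ≤ sumFin m hi′ → Between m lo′ hi′ D′
  recurse = sumFin-between m lo′ hi′ (λ i → lo≤hi (fsuc i))
  cons : ∀ {v D′} → lo 0F ≤ v × v ≤ hi 0F → v + D′ ≡ D → Between m lo′ hi′ D′ → Between (suc m) lo hi D
  cons {v} v∈ v+D′≡D (p , p∈ , Σp) = (λ { 0F → v ; (fsuc i) → p i }) , (λ { 0F → v∈ ; (fsuc i) → p∈ i }) ,
                                     trans (cong (v +_) Σp) v+D′≡D
  L≤D : L ≤ D
  L≤D = ≤-trans (m≤n+m L (lo 0F)) Σlo≤D
  choose : Dec (hi 0F ≤ D ∸ L) → Between (suc m) lo hi D
  choose (yes hi₀≤D∸L) = cons (lo≤hi 0F , ≤-refl) (m+[n∸m]≡n hi₀≤D)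
                              (recurse (m+n≤o⇒m≤o∸n L (subst (_≤ D) (+-comm (hi 0F) L)
                                                            (m≤o∸n⇒m+n≤o (hi 0F) L≤D hi₀≤D∸L)))
                                       (m≤n+o⇒m∸n≤o D (hi 0F) D≤Σhi))
    where hi₀≤D : hi 0F ≤ D
          hi₀≤D = ≤-trans hi₀≤D∸L (m∸n≤m D L)
  choose (no hi₀≰D∸L) = cons (m+n≤o⇒m≤o∸n (lo 0F) Σlo≤D , <⇒≤ (≰⇒> hi₀≰D∸L)) (m∸n+n≡m L≤D)
                             (recurse ≤-refl (sumFin-mono-≤ m (λ i → lo≤hi (fsuc i))))

multiple-between : ∀ a N .{{_ : NonZero N}} → ∃ λ c → a ≤ c * N × c * N ≤ a + pred N
multiple-between a N = c , +-cancelʳ-≤ (pred N) a (c * N) a≤ , m/n*n≤m (a + pred N) N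
  where
  c : ℕ
  c = (a + pred N) / N
  a≤ : a + pred N ≤ c * N + pred N
  a≤ = begin
    a + pred N                    ≡⟨ m≡m%n+[m/n]*n (a + pred N) N ⟩
    (a + pred N) % N + c * N      ≤⟨ +-monoˡ-≤ (c * N) (<⇒≤pred (m%n<n (a + pred N) N)) ⟩
    pred N + c * N                ≡⟨ +-comm (pred N) (c * N) ⟩
    c * N + pred N                ∎
    where open ≤-Reasoning

complement-label : ∀ {k s v} → v < s → s ≤ k + v → 1 ≤ s ∸ v × s ∸ v ≤ k
complement-label {k} {s} {v} v<s s≤k+v = m<n⇒0<n∸m v<s , m≤n+o⇒m∸n≤o s v (subst (s ≤_) (+-comm k v) s≤k+v)

-- The spine c_0, …, c_{k+m-1} is split into a first block of k vertices, where the label of a c_i ranges over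
-- [1, i + 1], and a second block, where the label of a c_{k+j} ranges over [j + 2, k]; the label of b c_i is then
-- forced to be i + 2 minus that of a c_i.
module Blocks (k m : ℕ) (m<k : m < k) where

  lo hi : Fin (k + m) → ℕ
  lo x = [ (λ _ → 1) , (λ j → 2 + toℕ j) ]′ (splitAt k x)
  hi x = [ (λ i → 1 + toℕ i) , (λ _ → k) ]′ (splitAt k x)

  SpokeLabel : Fin (k + m) → ℕ → Set
  SpokeLabel x v = (1 ≤ v × v ≤ k) × (v < 2 + toℕ x × 2 + toℕ x ≤ k + v)

  spokeLabel : ∀ x {v} → lo x ≤ v → v ≤ hi x → SpokeLabel x v
  spokeLabel x {v} with splitAt k x in eq
  ... | inj₁ i rewrite sym (splitAt⁻¹-↑ˡ eq) | toℕ-↑ˡ i m = λ 1≤v v≤1+i →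
        (1≤v , ≤-trans v≤1+i (toℕ<n i)) ,
        (s≤s v≤1+i , subst (_≤ k + v) (+-comm (suc (toℕ i)) 1) (+-mono-≤ (toℕ<n i) 1≤v))
  ... | inj₂ j rewrite sym (splitAt⁻¹-↑ʳ eq) | toℕ-↑ʳ k j = λ 2+j≤v v≤k →
        (≤-trans (s≤s z≤n) 2+j≤v , v≤k) , (s≤s (≤-trans v≤k (≤-trans (m≤m+n k (toℕ j)) (n≤1+n _))) ,
          subst (_≤ k + v) (trans (+-suc k (suc (toℕ j))) (cong suc (+-suc k (toℕ j)))) (+-monoʳ-≤ k 2+j≤v))

  lo≤hi : ∀ x → lo x ≤ hi x
  lo≤hi x with splitAt k x
  ... | inj₁ i = s≤s z≤n
  ... | inj₂ j = ≤-trans (s≤s (toℕ<n j)) m<k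

  sumFin-lo : sumFin (k + m) lo ≡ k + (m * 2 + sumFin m toℕ)
  sumFin-lo = trans (sumFin-++ k m lo) (cong₂ _+_
    (trans (sumFin-cong k (λ i → cong [ (λ _ → 1) , (λ j → 2 + toℕ j) ]′ (splitAt-↑ˡ k i m)))
           (trans (sumFin-const k 1) (*-identityʳ k)))
    (trans (sumFin-cong m (λ j → cong [ (λ _ → 1) , (λ j → 2 + toℕ j) ]′ (splitAt-↑ʳ k m j)))
           (sumFin-shift m 2)))

  sumFin-hi : sumFin (k + m) hi ≡ k + sumFin k toℕ + m * k
  sumFin-hi = trans (sumFin-++ k m hi) (cong₂ _+_
    (trans (sumFin-cong k (λ i → cong [ (λ i → 1 + toℕ i) , (λ _ → k) ]′ (splitAt-↑ˡ k i m)))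
           (trans (sumFin-shift k 1) (cong (_+ sumFin k toℕ) (*-identityʳ k))))
    (trans (sumFin-cong m (λ j → cong [ (λ i → 1 + toℕ i) , (λ _ → k) ]′ (splitAt-↑ʳ k m j)))
           (sumFin-const m k)))

  -- a gets the weight c N and b then gets 1 modulo N, because the weights of all vertices sum to 2 r + Σ (i + 2).
  admits : ∀ r c → 1 ≤ r → r ≤ k →
           r + (k + (m * 2 + sumFin m toℕ)) ≤ c * (2 + (k + m)) →
           c * (2 + (k + m)) ≤ r + (k + sumFin k toℕ + m * k) →
           (r * 2 + ((k + m) * 2 + sumFin (k + m) toℕ)) % (2 + (k + m)) ≡ 1 →
           Admits (book (k + m)) k
  admits r c 1≤r r≤k r+Σlo≤cN cN≤r+Σhi residue =
    book-admits r p q (1≤r , r≤k) labels a↦0 b↦1 c↦i+2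
    where
    N : ℕ
    N = 2 + (k + m)
    r≤cN : r ≤ c * N
    r≤cN = ≤-trans (m≤m+n r _) r+Σlo≤cN
    choice : Between (k + m) lo hi (c * N ∸ r)
    choice = sumFin-between (k + m) lo hi lo≤hi
      (m+n≤o⇒m≤o∸n _ (subst (_≤ c * N) (trans (cong (r +_) (sym sumFin-lo)) (+-comm r _)) r+Σlo≤cN))
      (m≤n+o⇒m∸n≤o (c * N) r (subst (λ s → c * N ≤ r + s) (sym sumFin-hi) cN≤r+Σhi))
    p q : Fin (k + m) → ℕ
    p = proj₁ choice
    q x = 2 + toℕ x ∸ p x
    spoke : ∀ x → SpokeLabel x (p x)
    spoke x = spokeLabel x (proj₁ (proj₁ (proj₂ choice) x)) (proj₂ (proj₁ (proj₂ choice) x))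
    labels : ∀ x → (1 ≤ p x × p x ≤ k) × (1 ≤ q x × q x ≤ k)
    labels x = proj₁ (spoke x) , complement-label (proj₁ (proj₂ (spoke x))) (proj₂ (proj₂ (spoke x)))
    p+q : ∀ x → p x + q x ≡ 2 + toℕ x
    p+q x = m+[n∸m]≡n (<⇒≤ (proj₁ (proj₂ (spoke x))))
    r+Σp≡cN : r + sumFin (k + m) p ≡ c * N
    r+Σp≡cN = trans (cong (r +_) (proj₂ (proj₂ choice))) (m+[n∸m]≡n r≤cN)
    a↦0 : (r + sumFin (k + m) p) % N ≡ 0
    a↦0 = trans (cong (_% N) r+Σp≡cN) (m*n%n≡0 c N)
    b↦1 : (r + sumFin (k + m) q) % N ≡ 1
    b↦1 = begin
      (r + Σq) % N                                        ≡⟨ [m+kn]%n≡m%n (r + Σq) c N ⟨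
      (r + Σq + c * N) % N                                ≡⟨ cong (λ s → (r + Σq + s) % N) r+Σp≡cN ⟨
      (r + Σq + (r + Σp)) % N                             ≡⟨ cong (_% N) (regroup r Σp Σq) ⟩
      (r * 2 + (Σp + Σq)) % N                             ≡⟨ cong (λ s → (r * 2 + s) % N) (sumFin-+ (k + m) p q) ⟨
      (r * 2 + sumFin (k + m) (λ x → p x + q x)) % N      ≡⟨ cong (λ s → (r * 2 + s) % N) (sumFin-cong (k + m) p+q) ⟩
      (r * 2 + sumFin (k + m) (λ x → 2 + toℕ x)) % N      ≡⟨ cong (λ s → (r * 2 + s) % N) (sumFin-shift (k + m) 2) ⟩
      (r * 2 + ((k + m) * 2 + sumFin (k + m) toℕ)) % N    ≡⟨ residue ⟩
      1                                                   ∎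
      where
      open ≡-Reasoning
      Σp Σq : ℕ
      Σp = sumFin (k + m) p
      Σq = sumFin (k + m) q
      regroup : ∀ r Σp Σq → r + Σq + (r + Σp) ≡ r * 2 + (Σp + Σq)
      regroup = solve-∀
    c↦i+2 : ∀ x → (p x + q x) % N ≡ 2 + toℕ x
    c↦i+2 x = trans (cong (_% N) (p+q x)) (m<n⇒m%n≡m (s≤s (s≤s (toℕ<n x))))

  admits-with-slack : ∀ r → 1 ≤ r → r ≤ k →
                      k + (m * 2 + sumFin m toℕ) + suc (k + m) ≤ k + sumFin k toℕ + m * k →
                      (r * 2 + ((k + m) * 2 + sumFin (k + m) toℕ)) % (2 + (k + m)) ≡ 1 →
                      Admits (book (k + m)) k
  admits-with-slack r 1≤r r≤k slack residue with multiple-between (r + (k + (m * 2 + sumFin m toℕ))) (2 + (k + m))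
  ... | c , r+Σlo≤cN , cN≤r+Σlo+N-1 = admits r c 1≤r r≤k r+Σlo≤cN
        (≤-trans cN≤r+Σlo+N-1 (≤-trans (≤-reflexive (+-assoc r _ _)) (+-monoʳ-≤ r slack))) residue

  -- sk, sm, sn are the triangular numbers of k, m, k + m, δ is the excess of the slack over N − 1, and c′ is the
  -- quotient of 2 r + Σ (i + 2) by N; as polynomial identities these are discharged by the ring solver below.
  admits-closed-form : ∀ r sk sm sn δ c′ → 1 ≤ r → r ≤ k →
    sk * 2 + k ≡ k * k → sm * 2 + m ≡ m * m → sn * 2 + (k + m) ≡ (k + m) * (k + m) →
    k + (m * 2 + sm) + suc (k + m) + δ ≡ k + sk + m * k →
    r * 2 + ((k + m) * 2 + sn) ≡ 1 + c′ * (2 + (k + m)) →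
    Admits (book (k + m)) k
  admits-closed-form r sk sm sn δ c′ 1≤r r≤k k-tri m-tri n-tri slack residue = admits-with-slack r 1≤r r≤k
    (subst₂ (λ a b → k + (m * 2 + a) + suc (k + m) ≤ k + b + m * k)
            (sym (triangular m sm m-tri)) (sym (triangular k sk k-tri))
            (subst (k + (m * 2 + sm) + suc (k + m) ≤_) slack (m≤m+n _ δ)))
    (subst (λ s → (r * 2 + ((k + m) * 2 + s)) % (2 + (k + m)) ≡ 1) (sym (triangular (k + m) sn n-tri))
           (trans (cong (_% (2 + (k + m))) residue) ([m+kn]%n≡m%n 1 c′ (2 + (k + m)))))

-- r = 1 serves when N is odd, since then Σ (i + 2) ≡ −1 (mod N); for N = 4t + 8 take r = t + 3.
admits-book-6+4t : ∀ t → Admits (book ((4 + t * 2) + (2 + t * 2))) (4 + t * 2)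
admits-book-6+4t t = Blocks.admits-closed-form (4 + t * 2) (2 + t * 2) (n≤1+n _) (3 + t)
  ((2 + t) * (3 + t * 2)) ((1 + t) * (1 + t * 2)) ((3 + t * 2) * (5 + t * 4)) (2 + t * 8 + t * t * 4) (4 + t * 2)
  (s≤s z≤n) (s≤s (s≤s (s≤s (≤-trans (m≤m*n t 2) (n≤1+n _)))))
  (solve (t ∷ [])) (solve (t ∷ [])) (solve (t ∷ [])) (solve (t ∷ [])) (solve (t ∷ []))

admits-book-7+4t : ∀ t → Admits (book ((4 + t * 2) + (3 + t * 2))) (4 + t * 2)
admits-book-7+4t t = Blocks.admits-closed-form (4 + t * 2) (3 + t * 2) ≤-refl 1
  ((2 + t) * (3 + t * 2)) ((3 + t * 2) * (1 + t)) ((7 + t * 4) * (3 + t * 2)) (1 + t * 8 + t * t * 4) (4 + t * 2)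
  (s≤s z≤n) (s≤s z≤n)
  (solve (t ∷ [])) (solve (t ∷ [])) (solve (t ∷ [])) (solve (t ∷ [])) (solve (t ∷ []))

admits-book-9+4t : ∀ t → Admits (book ((5 + t * 2) + (4 + t * 2))) (5 + t * 2)
admits-book-9+4t t = Blocks.admits-closed-form (5 + t * 2) (4 + t * 2) ≤-refl 1
  ((5 + t * 2) * (2 + t)) ((2 + t) * (3 + t * 2)) ((9 + t * 4) * (4 + t * 2)) (6 + t * 12 + t * t * 4) (5 + t * 2)
  (s≤s z≤n) (s≤s z≤n)
  (solve (t ∷ [])) (solve (t ∷ [])) (solve (t ∷ [])) (solve (t ∷ [])) (solve (t ∷ []))

admits-book-2 : Admits (book 2) 2
admits-book-2 = Blocks.admits 2 0 (s≤s z≤n) 2 1 (s≤s z≤n) ≤-refl ≤-refl (n≤1+n 4) refl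

admits-book-3 : Admits (book 3) 2
admits-book-3 = Blocks.admits 2 1 ≤-refl 1 1 (s≤s z≤n) (s≤s z≤n) ≤-refl (n≤1+n 5) refl

admits-book-5 : Admits (book 5) 4
admits-book-5 = Blocks.admits 4 1 (s≤s (s≤s z≤n)) 1 1 (s≤s z≤n) (s≤s z≤n) ≤-refl (m≤m+n 7 8) refl

admits-book-1 : Admits (book 1) 3
admits-book-1 = book-admits 1 (λ _ → 2) (λ _ → 3) (s≤s z≤n , s≤s z≤n)
  (λ _ → (s≤s z≤n , s≤s (s≤s z≤n)) , (s≤s z≤n , ≤-refl)) refl refl (λ { 0F → refl })

⌈k+m+1/2⌉≡k : ∀ k m → k ≡ suc m ⊎ k ≡ 2 + m → ⌈ k + m + 1 /2⌉ ≡ k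
⌈k+m+1/2⌉≡k k m (inj₁ refl) = trans (cong ⌈_/2⌉ (odd m)) (sym (n≡⌈n+n/2⌉ (suc m)))
  where odd : ∀ m → suc m + m + 1 ≡ suc m + suc m
        odd = solve-∀
⌈k+m+1/2⌉≡k k m (inj₂ refl) = trans (cong ⌊_/2⌋ (even m)) (sym (n≡⌊n+n/2⌋ (2 + m)))
  where even : ∀ m → suc (2 + m + m + 1) ≡ 2 + m + (2 + m)
        even = solve-∀

ms-book-of-admits : ∀ {n k} → ⌈ n + 1 /2⌉ ≡ k → Admits (book n) k → HasMS (book n) (fin ⌈ n + 1 /2⌉)
ms-book-of-admits refl admits = admits , λ _ → ⌈n+1/2⌉≤ms

ms-book-of-blocks : ∀ {n} k m → n ≡ k + m → k ≡ suc m ⊎ k ≡ 2 + m → Admits (book (k + m)) k →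
                    HasMS (book n) (fin ⌈ n + 1 /2⌉)
ms-book-of-blocks k m refl k≡ = ms-book-of-admits (⌈k+m+1/2⌉≡k k m k≡)

ms-book-1 : HasMS (book 1) (fin 3)
ms-book-1 = admits-book-1 , λ j admits → ≮⇒≥ (λ j<3 → ¬admits-book-1 j (≤-pred j<3) admits)

ms-book-5 : HasMS (book 5) (fin 4)
ms-book-5 = admits-book-5 , λ j admits → ≮⇒≥ (λ j<4 →
  ¬admits-book-5-3 (subst (Admits (book 5)) (≤-antisym (≤-pred j<4) (⌈n+1/2⌉≤ms admits)) admits))

data Residue4 : ℕ → Set where
  4t   : ∀ t → Residue4 (t * 4)
  4t+1 : ∀ t → Residue4 (1 + t * 4)
  4t+2 : ∀ t → Residue4 (2 + t * 4)
  4t+3 : ∀ t → Residue4 (3 + t * 4)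

residue4 : ∀ n → Residue4 n
residue4 n with n divMod 4
... | result t 0F refl = 4t t
... | result t 1F refl = 4t+1 t
... | result t 2F refl = 4t+2 t
... | result t 3F refl = 4t+3 t

ms-book : ∀ n → n ≢ 1 → n ≢ 5 → n % 4 ≢ 0 → HasMS (book n) (fin ⌈ n + 1 /2⌉)
ms-book n n≢1 n≢5 n%4≢0 with residue4 n
... | 4t t = contradiction ([m+kn]%n≡m%n 0 t 4) n%4≢0
... | 4t+1 0 = contradiction refl n≢1
... | 4t+1 1 = contradiction refl n≢5
... | 4t+1 (suc (suc t)) =
  ms-book-of-blocks {1 + suc (suc t) * 4} (5 + t * 2) (4 + t * 2) (solve (t ∷ [])) (inj₁ refl) (admits-book-9+4t t)
... | 4t+2 0 = ms-book-of-blocks 2 0 refl (inj₂ refl) admits-book-2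
... | 4t+2 (suc t) =
  ms-book-of-blocks {2 + suc t * 4} (4 + t * 2) (2 + t * 2) (solve (t ∷ [])) (inj₂ refl) (admits-book-6+4t t)
... | 4t+3 0 = ms-book-of-blocks 2 1 refl (inj₁ refl) admits-book-3
... | 4t+3 (suc t) =
  ms-book-of-blocks {3 + suc t * 4} (4 + t * 2) (3 + t * 2) (solve (t ∷ [])) (inj₁ refl) (admits-book-7+4t t)

theorem2 : (n : ℕ) → 1 ≤ n →
    (n ≡ 1 → HasMS (book n) (fin 3)) ×
    (n ≡ 5 → HasMS (book n) (fin 4)) ×
    (n % 4 ≡ 0 → HasMS (book n) ∞) ×
    (n ≢ 1 → n ≢ 5 → n % 4 ≢ 0 → HasMS (book n) (fin ⌈ n + 1 /2⌉))
theorem2 n _ = (λ { refl → ms-book-1 }) , (λ { refl → ms-book-5 }) , ¬admits-book-4∣n n , ms-book n
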